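{- Let $S$ be a signed star $K_{1,m+n}$ having $m$ positive edges and $n$ negative edges. Then $S$ is a parity signed graph if and only if $n=m$, or $n=m+2$, or $n=m+1$.
   Context: A signed graph is a pair $S=(G,\sigma)$ with $G$ a graph and $\sigma:E(G)\to\{+,-\}$. For a graph $G$ with $N$ vertices and a bijection $f:V(G)\to\{1,\dots,N\}$, define $\sigma_f(uv)=+$ if $f(u),f(v)$ have the same parity and $\sigma_f(uv)=-$ otherwise. $S$ is a parity signed graph (has a parity labelling) if $\sigma=\sigma_f$ for some such bijection $f$. -}

module Defs where

open import Data.Nat using (ℕ; zero; suc; _+_; _%_; _≡ᵇ_)
open import Data.Fin using (Fin; toℕ) renaming (zero to fzero; suc to fsuc)
open import Data.Bool using (if_then_else_)
open import Data.Product using (Σ; _×_)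
open import Relation.Binary.PropositionalEquality using (_≡_)
open import Function.Definitions using (Bijective)

data Sign : Set where
  plus minus : Sign

-- A signed graph on the vertex set Fin N: an adjacency relation
-- (edges, viewed in both orientations) together with a sign on each edge.
record SignedGraph (N : ℕ) : Set₁ where
  field
    Adj  : Fin N → Fin N → Set
    sign : ∀ {u v} → Adj u v → Sign

-- The label of vertex u under f : Fin N → Fin N, taken in {1, …, N}.
label : ∀ {N} → (Fin N → Fin N) → Fin N → ℕ
label f u = suc (toℕ (f u))

σ[_] : ∀ {N} → (Fin N → Fin N) → Fin N → Fin N → Sign
σ[ f ] u v = if (label f u % 2) ≡ᵇ (label f v % 2) then plus else minus

IsParitySigned : ∀ {N} → SignedGraph N → Set
IsParitySigned {N} S =
  Σ (Fin N → Fin N) λ f → Bijective _≡_ _≡_ f ×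
    (∀ u v (e : SignedGraph.Adj S u v) → SignedGraph.sign S e ≡ σ[ f ] u v)

-- The star K_{1,k}: vertex fzero is the centre, fsuc i are the k leaves.
data StarAdj {k : ℕ} : Fin (suc k) → Fin (suc k) → Set where
  out : (i : Fin k) → StarAdj fzero (fsuc i)
  inn : (i : Fin k) → StarAdj (fsuc i) fzero

signedStar : ∀ {k} → (Fin k → Sign) → SignedGraph (suc k)
signedStar {k} τ = record { Adj = StarAdj ; sign = sg }
  where
  sg : ∀ {u v} → StarAdj u v → Sign
  sg (out i) = τ i
  sg (inn i) = τ i

countPlus : ∀ {k} → (Fin k → Sign) → ℕ
countPlus {zero}  τ = 0
countPlus {suc k} τ with τ fzero
... | plus  = suc (countPlus (λ i → τ (fsuc i)))
... | minus = countPlus (λ i → τ (fsuc i))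

-- Under a labelling f, the edge to a leaf is positive exactly when the leaf's label has the
-- parity of the centre's label.  So the labels of the centre and of the m positive leaves form
-- the whole parity class of the centre's label in {1, …, m + n + 1}, which therefore has m + 1
-- elements; conversely, any label whose class has m + 1 elements can serve as the centre, the
-- leaves being matched to the remaining labels by a permutation respecting the signs.  The
-- parity classes of {1, …, N} have sizes ⌈N/2⌉ and ⌊N/2⌋, and m + 1 is such a size for
-- N = m + n + 1 exactly when n ∈ {m, m + 1, m + 2}.
module Submission where

open import Defs
open import Data.Nat using (ℕ; _+_)
open import Data.Fin using (Fin)
open import Data.Sum using (_⊎_)
open import Relation.Binary.PropositionalEquality using (_≡_)
open import Function.Bundles using (_⇔_)

open import Data.Nat using (zero; suc; _%_; _≡ᵇ_; _≤_; _<_; z≤n; s≤s; s≤s⁻¹)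
open import Data.Nat.Properties
  using (+-0-commutativeMonoid; +-suc; +-comm; +-identityʳ; +-cancelˡ-≡; +-cancelˡ-≤; m≤n⇒∃[o]m+o≡n)
open import Data.Fin using (toℕ) renaming (zero to fzero; suc to fsuc)
import Data.Fin.Permutation as Perm
open Perm using (Permutation; _⟨$⟩ʳ_; lift₀; _∘ₚ_; transpose)
open import Data.Vec.Functional using (_∷_)
open import Data.Bool using (if_then_else_)
open import Data.Product using (uncurry; Σ; ∃; _,_; _×_)
open import Data.Empty using (⊥-elim)
open import Data.Sum using (inj₁; inj₂)
open import Function using (id; _∘_)
open import Function.Bundles using (Bijection; mk⤖; mk⇔; Equivalence)
open import Function.Properties.Bijection using (Bijection⇒Inverse)
open import Function.Properties.Inverse using (Inverse⇒Bijection)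
open import Relation.Nullary using (Dec; yes; no)
open import Relation.Binary.Definitions using (DecidableEquality)
open import Relation.Binary.PropositionalEquality using (_≗_; refl; sym; trans; cong; subst; module ≡-Reasoning)
open import Data.Nat.Tactic.RingSolver using (solve-∀)
open import Algebra.Properties.CommutativeMonoid.Sum +-0-commutativeMonoid using (sum; sum-cong-≗; sum-permute)

private variable
  n : ℕ

indicator : ∀ {p} {P : Set p} → Dec P → ℕ
indicator (yes _) = 1
indicator (no _)  = 0

module Multiplicity {a} {A : Set a} (_≟_ : DecidableEquality A) where

  count : A → (Fin n → A) → ℕ
  count x g = sum (λ i → indicator (g i ≟ x))

  count-cong : ∀ x {g h : Fin n → A} → g ≗ h → count x g ≡ count x h
  count-cong x g≗h = sum-cong-≗ (cong (λ y → indicator (y ≟ x)) ∘ g≗h)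

  count-permute : ∀ x (g : Fin n → A) (π : Permutation n n) →
    count x (g ∘ (π ⟨$⟩ʳ_)) ≡ count x g
  count-permute x g π = sym (sum-permute (λ i → indicator (g i ≟ x)) π)

  count-head : ∀ (g : Fin (suc n) → A) → 0 < count (g fzero) g
  count-head g with g fzero ≟ g fzero
  ... | yes _ = s≤s z≤n
  ... | no g₀≢g₀ = ⊥-elim (g₀≢g₀ refl)

  count>0⇒∃ : ∀ x (h : Fin n → A) → 0 < count x h → ∃ λ j → h j ≡ x
  count>0⇒∃ {zero} x h ()
  count>0⇒∃ {suc n} x h 0<count with h fzero ≟ x
  ... | yes h₀≡x = fzero , h₀≡x
  ... | no _ = let j , hⱼ≡x = count>0⇒∃ x (h ∘ fsuc) 0<count in fsuc j , hⱼ≡x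

  count-tail : ∀ x (g h : Fin (suc n) → A) → g fzero ≡ h fzero →
    count x g ≡ count x h → count x (g ∘ fsuc) ≡ count x (h ∘ fsuc)
  count-tail x g h g₀≡h₀ g≡h =
    +-cancelˡ-≡ (indicator (g fzero ≟ x)) _ _
      (trans g≡h (cong (λ y → indicator (y ≟ x) + count x (h ∘ fsuc)) (sym g₀≡h₀)))

  -- Move some j with h j ≡ g 0 to the front by a transposition, then recurse on the tails.
  permutation-of-counts : ∀ (g h : Fin n → A) → (∀ x → count x g ≡ count x h) →
    Σ (Permutation n n) λ π → ∀ i → h (π ⟨$⟩ʳ i) ≡ g i
  permutation-of-counts {zero} g h _ = Perm.id , λ ()
  permutation-of-counts {suc n} g h same
    with j , hⱼ≡g₀ ← count>0⇒∃ (g fzero) h (subst (0 <_) (same (g fzero)) (count-head g))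
    with π , tails-match ← permutation-of-counts (g ∘ fsuc) (h ∘ (transpose fzero j ⟨$⟩ʳ_) ∘ fsuc)
      (λ x → count-tail x g (h ∘ (transpose fzero j ⟨$⟩ʳ_)) (sym hⱼ≡g₀)
               (trans (same x) (sym (count-permute x h (transpose fzero j)))))
    = lift₀ π ∘ₚ transpose fzero j , λ { fzero → hⱼ≡g₀ ; (fsuc i) → tails-match i }

_≟ˢ_ : DecidableEquality Sign
plus  ≟ˢ plus  = yes refl
plus  ≟ˢ minus = no λ ()
minus ≟ˢ plus  = no λ ()
minus ≟ˢ minus = yes refl

open Multiplicity _≟ˢ_

countPlus≡count : ∀ (τ : Fin n → Sign) → countPlus τ ≡ count plus τ
countPlus≡count {zero} τ = refl
countPlus≡count {suc n} τ with τ fzero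
... | plus  = cong suc (countPlus≡count (τ ∘ fsuc))
... | minus = countPlus≡count (τ ∘ fsuc)

count-plus+count-minus : ∀ (g : Fin n → Sign) → count plus g + count minus g ≡ n
count-plus+count-minus {zero} g = refl
count-plus+count-minus {suc n} g with g fzero
... | plus  = cong suc (count-plus+count-minus (g ∘ fsuc))
... | minus = trans (+-suc _ _) (cong suc (count-plus+count-minus (g ∘ fsuc)))

count-plus⇒count : ∀ (g h : Fin n → Sign) → count plus g ≡ count plus h → ∀ s → count s g ≡ count s h
count-plus⇒count g h same plus  = same
count-plus⇒count {n} g h same minus = +-cancelˡ-≡ (count plus g) _ _ (begin
  count plus g + count minus g ≡⟨ count-plus+count-minus g ⟩
  n                            ≡⟨ count-plus+count-minus h ⟨
  count plus h + count minus h ≡⟨ cong (_+ count minus h) same ⟨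
  count plus g + count minus h ∎)
  where open ≡-Reasoning

sameParity : ℕ → ℕ → Sign
sameParity a b = if a % 2 ≡ᵇ b % 2 then plus else minus

sameParity-refl : ∀ a → sameParity a a ≡ plus
sameParity-refl zero          = refl
sameParity-refl (suc zero)    = refl
sameParity-refl (suc (suc a)) = sameParity-refl a

sameParity-sym : ∀ a b → sameParity a b ≡ sameParity b a
sameParity-sym (suc (suc a)) b             = sameParity-sym a b
sameParity-sym a             (suc (suc b)) = sameParity-sym a b
sameParity-sym zero          zero          = refl
sameParity-sym zero          (suc zero)    = refl
sameParity-sym (suc zero)    zero          = refl
sameParity-sym (suc zero)    (suc zero)    = refl

sameParity-plus : ∀ a b c → sameParity a b ≡ plus → sameParity b c ≡ sameParity a c
sameParity-plus (suc (suc a)) b             c             = sameParity-plus a b c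
sameParity-plus a             (suc (suc b)) c             = sameParity-plus a b c
sameParity-plus a             b             (suc (suc c)) = sameParity-plus a b c
sameParity-plus zero          zero          zero          _ = refl
sameParity-plus zero          zero          (suc zero)    _ = refl
sameParity-plus (suc zero)    (suc zero)    zero          _ = refl
sameParity-plus (suc zero)    (suc zero)    (suc zero)    _ = refl
sameParity-plus zero          (suc zero)    _             ()
sameParity-plus (suc zero)    zero          _             ()

parityClass : ℕ → ℕ → ℕ
parityClass a N = count plus (λ (j : Fin N) → sameParity a (label id j))

parityClass-+2 : ∀ a N → parityClass a (2 + N) ≡ suc (parityClass a N)
parityClass-+2 zero          N = refl
parityClass-+2 (suc zero)    N = refl
parityClass-+2 (suc (suc a)) N = parityClass-+2 a N

parityClass-bounds : ∀ a N →
  parityClass a N + parityClass a N ≤ suc N × N ≤ parityClass a N + suc (parityClass a N)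
parityClass-bounds a             zero          = z≤n , z≤n
parityClass-bounds zero          (suc zero)    = z≤n , s≤s z≤n
parityClass-bounds (suc zero)    (suc zero)    = s≤s (s≤s z≤n) , s≤s z≤n
parityClass-bounds (suc (suc a)) (suc zero)    = parityClass-bounds a 1
parityClass-bounds a             (suc (suc N)) rewrite parityClass-+2 a N =
  let lower , upper = parityClass-bounds a N
      C = parityClass a N
  in s≤s (subst (_≤ 2 + N) (sym (+-suc C C)) (s≤s lower)) ,
     s≤s (subst (1 + N ≤_) (sym (+-suc C (suc C))) (s≤s upper))

parityClass-double : ∀ a r k → parityClass a (r + (k + k)) ≡ parityClass a r + k
parityClass-double a r zero    = trans (cong (parityClass a) (+-identityʳ r)) (sym (+-identityʳ _))
parityClass-double a r (suc k) = begin
  parityClass a (r + (suc k + suc k))     ≡⟨ cong (parityClass a) (shift r k) ⟩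
  parityClass a (2 + (r + (k + k)))       ≡⟨ parityClass-+2 a (r + (k + k)) ⟩
  suc (parityClass a (r + (k + k)))       ≡⟨ cong suc (parityClass-double a r k) ⟩
  suc (parityClass a r + k)               ≡⟨ +-suc (parityClass a r) k ⟨
  parityClass a r + suc k                 ∎
  where
  open ≡-Reasoning
  shift : ∀ r k → r + (suc k + suc k) ≡ 2 + (r + (k + k))
  shift = solve-∀

ParityClassSize : ℕ → ℕ → Set
ParityClassSize N x = Σ (Fin N) λ c → parityClass (label id c) N ≡ x

star-labelling⇔ : ∀ {k} (τ : Fin k → Sign) (f : Fin (suc k) → Fin (suc k)) →
  (∀ u v (e : StarAdj u v) → SignedGraph.sign (signedStar τ) e ≡ σ[ f ] u v) ⇔ (σ[ f ] fzero ≗ plus ∷ τ)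
star-labelling⇔ τ f = mk⇔
  (λ fits → λ { fzero → sameParity-refl (label f fzero) ; (fsuc i) → sym (fits _ _ (out i)) })
  (λ centre → λ { _ _ (out i) → sym (centre (fsuc i))
                ; _ _ (inn i) → trans (sym (centre (fsuc i)))
                                      (sameParity-sym (label f fzero) (label f (fsuc i))) })

parity-signed-star⇔ : ∀ {k} (τ : Fin k → Sign) →
  IsParitySigned (signedStar τ) ⇔ ParityClassSize (suc k) (suc (countPlus τ))
parity-signed-star⇔ {k} τ = mk⇔ to from
  where
  open ≡-Reasoning
  to : IsParitySigned (signedStar τ) → ParityClassSize (suc k) (suc (countPlus τ))
  to (f , bij , fits) = f fzero , (begin
    count plus (σ[ id ] (f fzero))            ≡⟨ count-permute plus (σ[ id ] (f fzero)) (Bijection⇒Inverse (mk⤖ bij)) ⟨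
    count plus (σ[ f ] fzero)                 ≡⟨ count-cong plus (Equivalence.to (star-labelling⇔ τ f) fits) ⟩
    suc (count plus τ)                        ≡⟨ cong suc (countPlus≡count τ) ⟨
    suc (countPlus τ)                         ∎)
  from : ParityClassSize (suc k) (suc (countPlus τ)) → IsParitySigned (signedStar τ)
  from (c , size) = uncurry matched (permutation-of-counts (plus ∷ τ) (σ[ id ] c)
    (count-plus⇒count (plus ∷ τ) (σ[ id ] c) (trans (cong suc (sym (countPlus≡count τ))) (sym size))))
    where
    matched : (π : Permutation (suc k) (suc k)) → (∀ i → σ[ id ] c (π ⟨$⟩ʳ i) ≡ (plus ∷ τ) i) →
      IsParitySigned (signedStar τ)
    matched π matches = f , Bijection.bijective (Inverse⇒Bijection π) , Equivalence.from (star-labelling⇔ τ f) centre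
      where
      f = π ⟨$⟩ʳ_
      centre : σ[ f ] fzero ≗ plus ∷ τ
      centre i = trans (sameParity-plus (label id c) (label f fzero) (label f i) (matches fzero)) (matches i)

parityClassSize⇒between : ∀ m n → ParityClassSize (suc (m + n)) (suc m) → m ≤ n × n ≤ m + 2
parityClassSize⇒between m n (c , size) =
  let lower , upper = parityClass-bounds (label id c) (suc (m + n))
  in m≤n (subst (λ x → x + x ≤ 2 + (m + n)) size lower) ,
     n≤m+2 (subst (λ x → 1 + (m + n) ≤ x + suc x) size upper)
  where
  m≤n : suc m + suc m ≤ suc (suc (m + n)) → m ≤ n
  m≤n le = s≤s⁻¹ (+-cancelˡ-≤ m (suc m) (suc n) (subst (m + suc m ≤_) (sym (+-suc m n)) (s≤s⁻¹ le)))
  n≤m+2 : suc (m + n) ≤ suc m + suc (suc m) → n ≤ m + 2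
  n≤m+2 le = subst (n ≤_) (+-comm 2 m) (+-cancelˡ-≤ m n (suc (suc m)) (s≤s⁻¹ le))

between⇒cases : ∀ {m n} → m ≤ n → n ≤ m + 2 → n ≡ m ⊎ n ≡ m + 2 ⊎ n ≡ m + 1
between⇒cases {m} m≤n n≤m+2 with d , refl ← m≤n⇒∃[o]m+o≡n m≤n = cases d (+-cancelˡ-≤ m d 2 n≤m+2)
  where
  cases : ∀ d → d ≤ 2 → m + d ≡ m ⊎ m + d ≡ m + 2 ⊎ m + d ≡ m + 1
  cases 0 _ = inj₁ (+-identityʳ m)
  cases 1 _ = inj₂ (inj₂ refl)
  cases 2 _ = inj₂ (inj₁ refl)
  cases (suc (suc (suc _))) (s≤s (s≤s ()))

parityClassSize-+double : ∀ {N} m r → N ≡ r + (m + m) → (c : Fin (r + (m + m))) →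
  parityClass (label id c) r ≡ 1 → ParityClassSize N (suc m)
parityClassSize-+double m r N≡ c size₁ =
  subst (λ N → ParityClassSize N (suc m)) (sym N≡)
    (c , trans (parityClass-double (label id c) r m) (cong (_+ m) size₁))

suc[m+[m+r]]≡suc[r]+[m+m] : ∀ m r → suc (m + (m + r)) ≡ suc r + (m + m)
suc[m+[m+r]]≡suc[r]+[m+m] = solve-∀

balanced⇒parityClassSize : ∀ m n → n ≡ m ⊎ n ≡ m + 2 ⊎ n ≡ m + 1 → ParityClassSize (suc (m + n)) (suc m)
balanced⇒parityClassSize m .m       (inj₁ refl) =
  parityClassSize-+double m 1 refl fzero refl
balanced⇒parityClassSize m .(m + 2) (inj₂ (inj₁ refl)) =
  parityClassSize-+double m 3 (suc[m+[m+r]]≡suc[r]+[m+m] m 2) (fsuc fzero) refl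
balanced⇒parityClassSize m .(m + 1) (inj₂ (inj₂ refl)) =
  parityClassSize-+double m 2 (suc[m+[m+r]]≡suc[r]+[m+m] m 1) fzero refl

theorem7 : (m n : ℕ) (τ : Fin (m + n) → Sign) → countPlus τ ≡ m →
    (IsParitySigned (signedStar τ) ⇔ (n ≡ m ⊎ n ≡ m + 2 ⊎ n ≡ m + 1))
theorem7 m n τ countPlus≡m = mk⇔
  (λ parity →
    let m≤n , n≤m+2 = parityClassSize⇒between m n (subst P countPlus≡m (to parity))
    in between⇒cases m≤n n≤m+2)
  (λ balanced → from (subst P (sym countPlus≡m) (balanced⇒parityClassSize m n balanced)))
  where
  open Equivalence (parity-signed-star⇔ τ)
  P : ℕ → Set
  P x = ParityClassSize (suc (m + n)) (suc x)
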